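{- Let $\mathfrak{D} = \langle \mathfrak{M}, \star\rangle$ be a class of dynamic models. The following axiom schema is valid in $\mathfrak{D}$ for any $\varphi \in \mathcal{L}_0$ and $\xi \in \mathcal{L}_\leq(\star)$ iff $\star$ is $\mathfrak{M}$-DP3-compliant: $$ {}[\star \varphi][<](\varphi \rightarrow \xi) \rightarrow (\neg \varphi \rightarrow [<] [\star \varphi] (\varphi \rightarrow \xi))$$
   Context: Fix a set $P$ of propositional letters; $\mathcal{L}_0$ is the classical propositional language over $P$. A (well-founded) preference model is $M=\langle W,\leq,v\rangle$ with $W$ a set of worlds, $\leq$ a reflexive, transitive relation on $W$ whose strict part $<$ is well-founded, and $v:P\to 2^W$ a valuation; $\mathit{Mod}(\mathcal{L}_\leq)$ is the class of all such models. A dynamic operator is a map $\star:\mathit{Mod}(\mathcal{L}_\leq)\times\mathcal{L}_0\to\mathit{Mod}(\mathcal{L}_\leq)$ with $\star(M,\varphi)=\langle W,\leq_{\star\varphi},v\rangle$ (same worlds and valuation). The language $\mathcal{L}_\leq(\star)$ is built from $P$ with $\neg,\wedge$, the universal modality $A$, the modalities $[\leq]$, $[<]$, and formulas $[\star\varphi]\xi$ with $\varphi\in\mathcal{L}_0$. A dynamic model is $D=\langle M,\star\rangle$, with $D,w\vDash A\xi$ iff every world satisfies $\xi$, $D,w\vDash[\leq]\xi$ iff every $w'\leq w$ satisfies $\xi$, $D,w\vDash[<]\xi$ iff every $w'<w$ satisfies $\xi$, and $D,w\vDash[\star\varphi]\xi$ iff $\langle\star(M,\varphi),\star\rangle,w\vDash\xi$.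 For a class $\mathfrak{M}$ of preference models over which $\star$ is closed, $\mathfrak{D}=\langle\mathfrak{M},\star\rangle$ is the class of dynamic models $\langle M,\star\rangle$ with $M\in\mathfrak{M}$; a formula is valid in $\mathfrak{D}$ if it is true at every world of every such model. $[\![\varphi]\!]$ denotes the set of worlds of the model under consideration satisfying $\varphi$. $\star$ is $\mathfrak{M}$-DP3-compliant if for every $M=\langle W,\leq,v\rangle\in\mathfrak{M}$, every $\varphi\in\mathcal{L}_0$ and all $w,w'\in W$, with $D=\langle M,\star\rangle$: (DP3a) if $w\in[\![\varphi]\!]$, $w'\notin[\![\varphi]\!]$ and $w<w'$, then for every $\xi\in\mathcal{L}_\leq(\star)$ with $D,w\vDash[\star\varphi]\xi$ there is $w''\in[\![\varphi]\!]$ with $D,w''\vDash[\star\varphi]\xi$ and $w''<_{\star\varphi}w'$. -}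

module Defs where

open import Level using (0ℓ)
open import Data.Product using (Σ; _×_; _,_)
open import Data.Empty using (⊥)
open import Relation.Nullary using (¬_)
open import Relation.Binary.Structures using (IsPreorder)
open import Relation.Binary.PropositionalEquality using (_≡_)
open import Induction.WellFounded using (WellFounded)

data Form₀ (P : Set) : Set where
  var  : P → Form₀ P
  ¬₀_  : Form₀ P → Form₀ P
  _∧₀_ : Form₀ P → Form₀ P → Form₀ P

Strict : {W : Set} → (W → W → Set) → W → W → Set
Strict _≤_ w w' = (w ≤ w') × ¬ (w' ≤ w)

record PrefRel (W : Set) : Set₁ where
  field
    _≤_        : W → W → Set
    isPreorder : IsPreorder _≡_ _≤_
    wf         : WellFounded (Strict _≤_)

record Model (P : Set) : Set₁ where
  field
    W   : Set
    rel : PrefRel W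
    v   : P → W → Set
  open PrefRel rel public
  _<_ : W → W → Set
  _<_ = Strict _≤_

DynOp : Set → Set₁
DynOp P = (M : Model P) → Form₀ P → PrefRel (Model.W M)

apply : {P : Set} → DynOp P → Model P → Form₀ P → Model P
apply ⋆ M φ = record { W = Model.W M ; rel = ⋆ M φ ; v = Model.v M }

data Form (P : Set) : Set where
  var   : P → Form P
  ¬'_   : Form P → Form P
  _∧'_  : Form P → Form P → Form P
  A     : Form P → Form P
  [≤]   : Form P → Form P
  [<]   : Form P → Form P
  [⋆_]_ : Form₀ P → Form P → Form P

emb : {P : Set} → Form₀ P → Form P
emb (var p)   = var p
emb (¬₀ φ)    = ¬' emb φ
emb (φ ∧₀ ψ)  = emb φ ∧' emb ψ

_⇒_ : {P : Set} → Form P → Form P → Form P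
φ ⇒ ξ = ¬' (φ ∧' (¬' ξ))

Sat : {P : Set} → DynOp P → (M : Model P) → Model.W M → Form P → Set
Sat ⋆ M w (var p)    = Model.v M p w
Sat ⋆ M w (¬' ξ)     = ¬ Sat ⋆ M w ξ
Sat ⋆ M w (ξ ∧' ζ)   = Sat ⋆ M w ξ × Sat ⋆ M w ζ
Sat ⋆ M w (A ξ)      = (w' : Model.W M) → Sat ⋆ M w' ξ
Sat ⋆ M w ([≤] ξ)    = (w' : Model.W M) → Model._≤_ M w' w → Sat ⋆ M w' ξ
Sat ⋆ M w ([<] ξ)    = (w' : Model.W M) → Model._<_ M w' w → Sat ⋆ M w' ξ
Sat ⋆ M w ([⋆ φ ] ξ) = Sat ⋆ (apply ⋆ M φ) w ξ

ModelClass : Set → Set₁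
ModelClass P = Model P → Set

Closed : {P : Set} → ModelClass P → DynOp P → Set₁
Closed {P} 𝔐 ⋆ = (M : Model P) → (φ : Form₀ P) → 𝔐 M → 𝔐 (apply ⋆ M φ)

Valid : {P : Set} → ModelClass P → DynOp P → Form P → Set₁
Valid {P} 𝔐 ⋆ ξ = (M : Model P) → 𝔐 M → (w : Model.W M) → Sat ⋆ M w ξ

Axiom33 : {P : Set} → Form₀ P → Form P → Form P
Axiom33 φ ξ = ([⋆ φ ] ([<] (emb φ ⇒ ξ))) ⇒ ((¬' emb φ) ⇒ ([<] ([⋆ φ ] (emb φ ⇒ ξ))))

DP3 : {P : Set} → ModelClass P → DynOp P → Set₁
DP3 {P} 𝔐 ⋆ =
  (M : Model P) → 𝔐 M → (φ : Form₀ P) → (w w' : Model.W M) →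
  Sat ⋆ M w (emb φ) → ¬ Sat ⋆ M w' (emb φ) → Model._<_ M w w' →
  (ξ : Form P) → Sat ⋆ M w ([⋆ φ ] ξ) →
  Σ (Model.W M) λ w'' →
    Sat ⋆ M w'' (emb φ) × Sat ⋆ M w'' ([⋆ φ ] ξ) × Model._<_ (apply ⋆ M φ) w'' w'

-- If DP3a failed at w < w' for some ξ, the instance of the axiom for ¬ξ would
-- be false at w': in the updated model no φ-world below w' satisfies ξ, while
-- w itself is a φ-world below w' (in the old order) satisfying [⋆φ]ξ.
-- Conversely, a counterexample u < w to the axiom at w is a φ-world with
-- [⋆φ]¬ξ below the ¬φ-world w, so DP3a yields a φ-world below w in the updated
-- order satisfying ¬ξ, contradicting the antecedent. Only the first direction
-- is classical: DP3a asks for an explicit witness.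
module Submission where

open import Defs
open import Level using (0ℓ)
open import Data.Product using (_×_; _,_; Σ)
open import Data.Product.Function.NonDependent.Propositional using (_×-⇔_)
open import Function.Bundles using (_⇔_; Equivalence)
open import Function.Construct.Identity using (⇔-id)
open import Function.Related.TypeIsomorphisms using (¬-cong-⇔)
open import Relation.Nullary using (¬_)
open import Axiom.ExcludedMiddle using (ExcludedMiddle)
open import Axiom.DoubleNegationElimination using (em⇒dne)

reorder : {P : Set} (M : Model P) → PrefRel (Model.W M) → Model P
reorder M R = record { W = Model.W M ; rel = R ; v = Model.v M }

Sat-emb-reorder : {P : Set} (⋆ : DynOp P) (M : Model P) (R : PrefRel (Model.W M))
  (ψ : Form₀ P) (w : Model.W M) → Sat ⋆ (reorder M R) w (emb ψ) ⇔ Sat ⋆ M w (emb ψ)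
Sat-emb-reorder ⋆ M R (var p)  w = ⇔-id _
Sat-emb-reorder ⋆ M R (¬₀ ψ)   w = ¬-cong-⇔ (Sat-emb-reorder ⋆ M R ψ w)
Sat-emb-reorder ⋆ M R (ψ ∧₀ χ) w = Sat-emb-reorder ⋆ M R ψ w ×-⇔ Sat-emb-reorder ⋆ M R χ w

module _ {P : Set} (⋆ : DynOp P) (M : Model P) (φ : Form₀ P) where
  open Model M using (W; _<_)

  private
    module Update {w : W} = Equivalence (Sat-emb-reorder ⋆ M (⋆ M φ) φ w)

  DP3a-Witness : Form P → W → Set
  DP3a-Witness ξ w' =
    Σ W λ w'' → Sat ⋆ M w'' (emb φ) × Sat ⋆ M w'' ([⋆ φ ] ξ) × Model._<_ (apply ⋆ M φ) w'' w'

  axiom33⇒¬¬DP3a-Witness : (ξ : Form P) {w w' : W} → Sat ⋆ M w' (Axiom33 φ (¬' ξ)) →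
    Sat ⋆ M w (emb φ) → ¬ Sat ⋆ M w' (emb φ) → w < w' → Sat ⋆ M w ([⋆ φ ] ξ) →
    ¬ ¬ DP3a-Witness ξ w'
  axiom33⇒¬¬DP3a-Witness ξ {w} {w'} axiom φw ¬φw' w<w' ξw ¬witness =
    axiom (⋆<-φ⇒¬ξ , λ consequent → consequent (¬φw' , ¬<⋆-φ⇒¬ξ))
    where
    ⋆<-φ⇒¬ξ : Sat ⋆ M w' ([⋆ φ ] ([<] (emb φ ⇒ (¬' ξ))))
    ⋆<-φ⇒¬ξ u u<w' (φu , ¬¬ξu) =
      ¬¬ξu λ ξu → ¬witness (u , Update.to φu , ξu , u<w')

    ¬<⋆-φ⇒¬ξ : ¬ Sat ⋆ M w' ([<] ([⋆ φ ] (emb φ ⇒ (¬' ξ))))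
    ¬<⋆-φ⇒¬ξ below = below w w<w' (Update.from φw , λ ¬ξw → ¬ξw ξw)

  DP3a-Witness⇒axiom33 : (ξ : Form P) {w : W} →
    ((u : W) → Sat ⋆ M u (emb φ) → ¬ Sat ⋆ M w (emb φ) → u < w →
      Sat ⋆ M u ([⋆ φ ] (¬' ξ)) → DP3a-Witness (¬' ξ) w) →
    Sat ⋆ M w (Axiom33 φ ξ)
  DP3a-Witness⇒axiom33 ξ dp3a (antecedent , ¬consequent) =
    ¬consequent λ (¬φw , ¬below) → ¬below λ u u<w (φu , ¬ξu) →
      let (w'' , φw'' , ¬ξw'' , w''<w) = dp3a u (Update.to φu) ¬φw u<w ¬ξu
      in antecedent w'' w''<w (Update.from φw'' , ¬ξw'')

proposition33 : ExcludedMiddle 0ℓ → (P : Set) → (𝔐 : ModelClass P) → (⋆ : DynOp P) →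
    Closed 𝔐 ⋆ →
    (((φ : Form₀ P) → (ξ : Form P) → Valid 𝔐 ⋆ (Axiom33 φ ξ)) → DP3 𝔐 ⋆)
    × (DP3 𝔐 ⋆ → ((φ : Form₀ P) → (ξ : Form P) → Valid 𝔐 ⋆ (Axiom33 φ ξ)))
proposition33 em P 𝔐 ⋆ _ = valid⇒DP3 , DP3⇒valid
  where
  valid⇒DP3 : ((φ : Form₀ P) (ξ : Form P) → Valid 𝔐 ⋆ (Axiom33 φ ξ)) → DP3 𝔐 ⋆
  valid⇒DP3 valid M M∈𝔐 φ w w' φw ¬φw' w<w' ξ ξw = em⇒dne em
    (axiom33⇒¬¬DP3a-Witness ⋆ M φ ξ (valid φ (¬' ξ) M M∈𝔐 w') φw ¬φw' w<w' ξw)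

  DP3⇒valid : DP3 𝔐 ⋆ → (φ : Form₀ P) (ξ : Form P) → Valid 𝔐 ⋆ (Axiom33 φ ξ)
  DP3⇒valid dp3 φ ξ M M∈𝔐 w =
    DP3a-Witness⇒axiom33 ⋆ M φ ξ λ u φu ¬φw u<w → dp3 M M∈𝔐 φ u w φu ¬φw u<w (¬' ξ)
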